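{- For every W-logic $\mathsf{WL}$ and all formulas $A,B$ of $\mathcal L$: if $\mathsf{WL}\vdash A\lor B$, then $\mathsf{WL}\vdash A$ or $\mathsf{WL}\vdash B$.
   Context: The language $\mathcal{L}$ consists of the formulas built from a countable set of propositional variables by $A ::= p \mid \bot \mid A\land A \mid A\lor A \mid A\to A \mid \Box A \mid \Diamond A$; $\top := \bot\to\bot$, $\neg A := A\to\bot$. Axiom schemes and rules (for all $A,B$): (Mon$_\Box$) from $A\to B$ infer $\Box A\to\Box B$; (Mon$_\Diamond$) from $A\to B$ infer $\Diamond A\to\Diamond B$; (C$_\Box$) $\Box A\land\Box B\to\Box(A\land B)$; (K$_\Diamond$) $\Box(A\to B)\to(\Diamond A\to\Diamond B)$; (N$_\Box$) $\Box\top$; (T$_\Box$) $\Box A\to A$; (T$_\Diamond$) $A\to\Diamond A$; (D) $\Box A\to\Diamond A$; (P$_\Diamond$) $\Diamond\top$; (Dual$_\land$) $\neg(\Box A\land\Diamond\neg A)$. The W-logics are obtained by adding to an axiomatisation of intuitionistic propositional logic (all $\mathcal L$-instances, with modus ponens): $\mathsf{WM}$ := Dual$_\land$ + Mon$_\Box$ + Mon$_\Diamond$; $\mathsf{WMN}$ := $\mathsf{WM}$+N$_\Box$; $\mathsf{WMC}$ := $\mathsf{WM}$+C$_\Box$+K$_\Diamond$; $\mathsf{WK}$ := $\mathsf{WMC}$+N$_\Box$; $\mathsf{WMP}$ := $\mathsf{WM}$+P$_\Diamond$; $\mathsf{WMNP}$ := $\mathsf{WMN}$+P$_\Diamond$;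 $\mathsf{WMD}$ := $\mathsf{WM}$+D+P$_\Diamond$; $\mathsf{WMND}$ := $\mathsf{WMN}$+D; $\mathsf{WMCD}$ := $\mathsf{WMC}$+D+P$_\Diamond$; $\mathsf{WKD}$ := $\mathsf{WK}$+D; $\mathsf{WMT}$, $\mathsf{WMNT}$, $\mathsf{WMCT}$, $\mathsf{WKT}$ := respectively $\mathsf{WM}$, $\mathsf{WMN}$, $\mathsf{WMC}$, $\mathsf{WK}$ + T$_\Box$ + T$_\Diamond$. $\mathsf{WL}\vdash A$ means $A$ is derivable from axiom instances of $\mathsf{WL}$ by modus ponens and the rules of $\mathsf{WL}$. -}

module Defs where

open import Data.Nat using (ℕ)
open import Data.Bool using (Bool; true; false)
open import Relation.Binary.PropositionalEquality using (_≡_)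

data Fm : Set where
  var  : ℕ → Fm
  ⊥'   : Fm
  _∧'_ : Fm → Fm → Fm
  _∨'_ : Fm → Fm → Fm
  _⇒_  : Fm → Fm → Fm
  □    : Fm → Fm
  ◇    : Fm → Fm

infixr 6 _∧'_
infixr 5 _∨'_
infixr 4 _⇒_

⊤' : Fm
⊤' = ⊥' ⇒ ⊥'

¬' : Fm → Fm
¬' A = A ⇒ ⊥'

data WLogic : Set where
  WM WMN WMC WK WMP WMNP WMD WMND WMCD WKD WMT WMNT WMCT WKT : WLogic

-- Which optional axioms each logic contains (Dual∧, Mon□, Mon◇ are in all).
hasN : WLogic → Bool
hasN WMN  = true
hasN WK   = true
hasN WMNP = true
hasN WMND = true
hasN WKD  = true
hasN WMNT = true
hasN WKT  = true
hasN _    = false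

-- C□ and K◇ come together
hasC : WLogic → Bool
hasC WMC  = true
hasC WK   = true
hasC WMCD = true
hasC WKD  = true
hasC WMCT = true
hasC WKT  = true
hasC _    = false

hasP : WLogic → Bool
hasP WMP  = true
hasP WMNP = true
hasP WMD  = true
hasP WMCD = true
hasP _    = false

hasD : WLogic → Bool
hasD WMD  = true
hasD WMND = true
hasD WMCD = true
hasD WKD  = true
hasD _    = false

-- T□ and T◇ come together
hasT : WLogic → Bool
hasT WMT  = true
hasT WMNT = true
hasT WMCT = true
hasT WKT  = true
hasT _    = false

infix 2 _⊢_
data _⊢_ (L : WLogic) : Fm → Set where
  ax-K    : ∀ A B → L ⊢ A ⇒ B ⇒ A
  ax-S    : ∀ A B C → L ⊢ (A ⇒ B ⇒ C) ⇒ (A ⇒ B) ⇒ A ⇒ C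
  ax-∧I   : ∀ A B → L ⊢ A ⇒ B ⇒ A ∧' B
  ax-∧E₁  : ∀ A B → L ⊢ A ∧' B ⇒ A
  ax-∧E₂  : ∀ A B → L ⊢ A ∧' B ⇒ B
  ax-∨I₁  : ∀ A B → L ⊢ A ⇒ A ∨' B
  ax-∨I₂  : ∀ A B → L ⊢ B ⇒ A ∨' B
  ax-∨E   : ∀ A B C → L ⊢ (A ⇒ C) ⇒ (B ⇒ C) ⇒ A ∨' B ⇒ C
  ax-efq  : ∀ A → L ⊢ ⊥' ⇒ A
  mp      : ∀ {A B} → L ⊢ A ⇒ B → L ⊢ A → L ⊢ B
  ax-Dual : ∀ A → L ⊢ ¬' (□ A ∧' ◇ (¬' A))
  mon□    : ∀ {A B} → L ⊢ A ⇒ B → L ⊢ □ A ⇒ □ B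
  mon◇    : ∀ {A B} → L ⊢ A ⇒ B → L ⊢ ◇ A ⇒ ◇ B
  ax-N    : hasN L ≡ true → L ⊢ □ ⊤'
  ax-C    : hasC L ≡ true → ∀ A B → L ⊢ □ A ∧' □ B ⇒ □ (A ∧' B)
  ax-Kd   : hasC L ≡ true → ∀ A B → L ⊢ □ (A ⇒ B) ⇒ ◇ A ⇒ ◇ B
  ax-P    : hasP L ≡ true → L ⊢ ◇ ⊤'
  ax-D    : hasD L ≡ true → ∀ A → L ⊢ □ A ⇒ ◇ A
  ax-T□   : hasT L ≡ true → ∀ A → L ⊢ □ A ⇒ A
  ax-T◇   : hasT L ≡ true → ∀ A → L ⊢ A ⇒ ◇ A

-- Aczel's slash: a formula is slashed when it is provable and, recursively,
-- its disjunctions are decided, its implications transport slashes, and its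
-- modal subformulas are slashed as well.  Every theorem of a W-logic is
-- slashed, and a slashed disjunction has a
-- provable disjunct.  Because □ A and ◇ A both carry a slash of A, the slash
-- of Dual∧ reduces to that of A ∧ ¬ A, which is empty; no separate
-- consistency argument is needed.
module Submission where

open import Defs
open import Data.Sum using (_⊎_; inj₁; inj₂; map)
open import Data.Product using (_×_; _,_; proj₁; proj₂)
open import Data.Empty using (⊥)
open import Function using (id)

Slash : WLogic → Fm → Set
Slash L (var n)  = L ⊢ var n
Slash L ⊥'       = ⊥
Slash L (A ∧' B) = Slash L A × Slash L B
Slash L (A ∨' B) = Slash L A ⊎ Slash L B
Slash L (A ⇒ B)  = (L ⊢ A ⇒ B) × (Slash L A → Slash L B)
Slash L (□ A)    = (L ⊢ □ A) × Slash L A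
Slash L (◇ A)    = (L ⊢ ◇ A) × Slash L A

∧-intro : ∀ {L A B} → L ⊢ A → L ⊢ B → L ⊢ A ∧' B
∧-intro {A = A} {B} a b = mp (mp (ax-∧I A B) a) b

Slash⇒⊢ : ∀ {L} A → Slash L A → L ⊢ A
Slash⇒⊢ (var n)  a         = a
Slash⇒⊢ (A ∧' B) (a , b)   = ∧-intro (Slash⇒⊢ A a) (Slash⇒⊢ B b)
Slash⇒⊢ (A ∨' B) (inj₁ a)  = mp (ax-∨I₁ A B) (Slash⇒⊢ A a)
Slash⇒⊢ (A ∨' B) (inj₂ b)  = mp (ax-∨I₂ A B) (Slash⇒⊢ B b)
Slash⇒⊢ (A ⇒ B)  (d , _)   = d
Slash⇒⊢ (□ A)    (d , _)   = d
Slash⇒⊢ (◇ A)    (d , _)   = d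

Slash-⊤ : ∀ {L} → Slash L ⊤'
Slash-⊤ = ax-efq ⊥' , id

⊢⇒Slash : ∀ {L A} → L ⊢ A → Slash L A
⊢⇒Slash (ax-K A B) = ax-K A B , λ a → mp (ax-K A B) (Slash⇒⊢ A a) , λ _ → a
⊢⇒Slash (ax-S A B C) = ax-S A B C , λ { (abc , fabc) →
  mp (ax-S A B C) abc , λ { (ab , fab) →
  mp (mp (ax-S A B C) abc) ab , λ a → proj₂ (fabc a) (fab a) } }
⊢⇒Slash (ax-∧I A B) = ax-∧I A B , λ a → mp (ax-∧I A B) (Slash⇒⊢ A a) , λ b → a , b
⊢⇒Slash (ax-∧E₁ A B) = ax-∧E₁ A B , proj₁
⊢⇒Slash (ax-∧E₂ A B) = ax-∧E₂ A B , proj₂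
⊢⇒Slash (ax-∨I₁ A B) = ax-∨I₁ A B , inj₁
⊢⇒Slash (ax-∨I₂ A B) = ax-∨I₂ A B , inj₂
⊢⇒Slash (ax-∨E A B C) = ax-∨E A B C , λ { (ac , fac) →
  mp (ax-∨E A B C) ac , λ { (bc , fbc) →
  mp (mp (ax-∨E A B C) ac) bc , λ { (inj₁ a) → fac a ; (inj₂ b) → fbc b } } }
⊢⇒Slash (ax-efq A) = ax-efq A , λ ()
⊢⇒Slash (mp d e) = proj₂ (⊢⇒Slash d) (⊢⇒Slash e)
⊢⇒Slash (ax-Dual A) = ax-Dual A , λ { ((_ , a) , (_ , (_ , ¬a))) → ¬a a }
⊢⇒Slash (mon□ d) = mon□ d , λ { (□a , a) → mp (mon□ d) □a , proj₂ (⊢⇒Slash d) a }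
⊢⇒Slash (mon◇ d) = mon◇ d , λ { (◇a , a) → mp (mon◇ d) ◇a , proj₂ (⊢⇒Slash d) a }
⊢⇒Slash (ax-N n) = ax-N n , Slash-⊤
⊢⇒Slash (ax-C c A B) = ax-C c A B , λ { ((□a , a) , (□b , b)) →
  mp (ax-C c A B) (∧-intro □a □b) , a , b }
⊢⇒Slash (ax-Kd c A B) = ax-Kd c A B , λ { (□ab , (_ , fab)) →
  mp (ax-Kd c A B) □ab , λ { (◇a , a) → mp (mp (ax-Kd c A B) □ab) ◇a , fab a } }
⊢⇒Slash (ax-P p) = ax-P p , Slash-⊤
⊢⇒Slash (ax-D d A) = ax-D d A , λ { (□a , a) → mp (ax-D d A) □a , a }
⊢⇒Slash (ax-T□ t A) = ax-T□ t A , proj₂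
⊢⇒Slash (ax-T◇ t A) = ax-T◇ t A , λ a → mp (ax-T◇ t A) (Slash⇒⊢ A a) , a

proposition3p7 : (L : WLogic) (A B : Fm) → L ⊢ A ∨' B → (L ⊢ A) ⊎ (L ⊢ B)
proposition3p7 L A B d = map (Slash⇒⊢ A) (Slash⇒⊢ B) (⊢⇒Slash d)
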